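{- Let $m\equiv 1\pmod 4$, $m\geq 5$, and let $M$ be a maximum induced matching of the grid $G_{4,m}$. Suppose the row $U_4=\{u_4v_1,\dots,u_4v_m\}$ contains exactly $\frac{m-1}{2}$ vertices saturated by $M$. Then no edge with both endpoints in $U_4$ (i.e., no edge joining $u_4v_i$ and $u_4v_{i+1}$) belongs to $M$.
   Context: For integers $n,m\geq 2$, the grid $G_{n,m}$ is the Cartesian product of the path $P_n=u_1u_2\cdots u_n$ and the path $P_m=v_1v_2\cdots v_m$; its vertices are written $u_iv_j$ ($1\le i\le n$, $1\le j\le m$), and $u_iv_j$, $u_kv_l$ are adjacent iff either $i=k$ and $|j-l|=1$, or $j=l$ and $|i-k|=1$. An induced matching of a graph $G$ is a set $M$ of pairwise vertex-disjoint edges such that no edge of $G$ joins endpoints of two distinct edges of $M$; a maximum induced matching is one of largest possible size. A vertex is saturated by $M$ if it is an endpoint of an edge of $M$. -}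

module Defs where

open import Data.Nat using (ℕ; suc; _+_; _≤_)
open import Data.Fin using (Fin; toℕ)
open import Data.Fin.Properties using () renaming (_≟_ to _≟ᶠ_)
open import Data.Product using (_×_; _,_; proj₁; proj₂)
open import Data.Sum using (_⊎_)
open import Data.List using (List; length; lookup; filter)
open import Data.List.Relation.Unary.Any using (Any; any?)
open import Relation.Nullary using (¬_; Dec)
open import Relation.Binary.PropositionalEquality using (_≡_; _≢_)
open import Data.Product.Properties using (≡-dec)
open import Relation.Nullary.Decidable using (_⊎-dec_)
open import Data.List using (allFin)

-- Vertices of the grid G_{n,m}: u_{i+1} v_{j+1} is represented by (i , j).
Vertex : ℕ → ℕ → Set
Vertex n m = Fin n × Fin m

PathAdj : {k : ℕ} → Fin k → Fin k → Set
PathAdj a b = (suc (toℕ a) ≡ toℕ b) ⊎ (suc (toℕ b) ≡ toℕ a)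

GridAdj : {n m : ℕ} → Vertex n m → Vertex n m → Set
GridAdj (i , j) (k , l) = (i ≡ k × PathAdj j l) ⊎ (j ≡ l × PathAdj i k)

Edge : ℕ → ℕ → Set
Edge n m = Vertex n m × Vertex n m

Separated : {n m : ℕ} → Vertex n m → Vertex n m → Set
Separated x y = x ≢ y × ¬ GridAdj x y

EdgesSeparated : {n m : ℕ} → Edge n m → Edge n m → Set
EdgesSeparated (a , b) (c , d) =
  Separated a c × Separated a d × Separated b c × Separated b d

-- An induced matching of G_{n,m}, as a list of edges: every entry is an edge
-- of the grid, and any two entries at distinct positions are separated
-- (in particular the list has no repeated edges, in either orientation).
IsInducedMatching : {n m : ℕ} → List (Edge n m) → Set
IsInducedMatching {n} {m} M =
  ((p : Fin (length M)) → GridAdj (proj₁ (lookup M p)) (proj₂ (lookup M p)))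
  × ((p q : Fin (length M)) → p ≢ q → EdgesSeparated (lookup M p) (lookup M q))

IsMaximumInducedMatching : {n m : ℕ} → List (Edge n m) → Set
IsMaximumInducedMatching {n} {m} M =
  IsInducedMatching M × ((M' : List (Edge n m)) → IsInducedMatching M' → length M' ≤ length M)

Saturates : {n m : ℕ} → Edge n m → Vertex n m → Set
Saturates (a , b) v = (a ≡ v) ⊎ (b ≡ v)

saturates? : {n m : ℕ} (e : Edge n m) (v : Vertex n m) → Dec (Saturates e v)
saturates? (a , b) v = ≡-dec _≟ᶠ_ _≟ᶠ_ a v ⊎-dec ≡-dec _≟ᶠ_ _≟ᶠ_ b v

IsSaturated : {n m : ℕ} → List (Edge n m) → Vertex n m → Set
IsSaturated M v = Any (λ e → Saturates e v) M

isSaturated? : {n m : ℕ} (M : List (Edge n m)) (v : Vertex n m) → Dec (IsSaturated M v)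
isSaturated? M v = any? (λ e → saturates? e v) M

rowSaturatedCount : {n m : ℕ} → List (Edge n m) → Fin n → ℕ
rowSaturatedCount {n} {m} M i = length (filter (λ j → isSaturated? M (i , j)) (allFin m))

-- Let S be the set of vertices saturated by M: every vertex of S has exactly one
-- neighbour in S, and |S| = 2|M|.  Weight the vertices of rows 1-3 by 4 and those of
-- row 4 by 2.  Since |M| ≥ m (take one vertical edge per column, alternating between
-- rows 1-2 and rows 3-4) and |S ∩ U₄| = (m-1)/2, the weight of S is
-- 4|S| - 2|S ∩ U₄| ≥ 8m - (m-1) = 7m + 1.  Conversely, scan the columns from left to
-- right, remembering the pattern of the last two columns, whether a horizontal row-4
-- edge has been passed, and the parity of the number of columns.  A potential on these
-- states, checked by exhaustive computation, grows by at least (weight of the new column) - 7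
-- at every step; comparing its values at the two ends shows that the weight of S is at
-- most 7m - 1 when m is odd and M has a horizontal edge in row 4.

module Submission where

open import Defs
open import Data.Nat using (ℕ; _≤_; _∸_; _/_; _%_)
open import Data.Fin using (Fin; fromℕ)
open import Data.Product using (_×_; proj₁; proj₂)
open import Data.List using (List)
open import Data.List.Relation.Unary.All using (All)
open import Relation.Nullary using (¬_)
open import Relation.Binary.PropositionalEquality using (_≡_)

open import Data.Bool using (Bool; true; false; T; not; _∧_; _∨_; if_then_else_)
open import Data.Bool.Properties using (T-∧; T-≡; not-involutive; not-¬)
open import Data.Empty using (⊥; ⊥-elim)
open import Data.Fin using (toℕ; zero; suc; cast)
open import Data.Fin.Patterns using (0F; 1F; 2F; 3F)
open import Data.Fin.Properties using (toℕ-injective; toℕ<n; cast-involutive) renaming (_≟_ to _≟ᶠ_; suc-injective to Fin-suc-injective)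
import Data.Fin.Properties as Finₚ
open import Data.List using ([]; _∷_; length; lookup; filter; tabulate)
open import Data.List.Properties using (length-tabulate; lookup-tabulate)
open import Data.List.Membership.Propositional using (_∈_)
open import Data.List.Membership.Propositional.Properties using (∈-lookup)
open import Data.List.Relation.Unary.Any as Any using (Any; index)
open import Data.List.Relation.Unary.Any.Properties using (lookup-index)
import Data.List.Relation.Unary.All as All
open import Data.Nat using (zero; suc; _+_; _*_; _<_; _≤?_; z≤n; s≤s)
open import Data.Nat.Properties
  using (+-*-semiring; +-assoc; +-identityʳ; +-comm; +-mono-≤; +-monoˡ-≤; +-monoʳ-≤; +-monoˡ-<; +-cancelˡ-≤;
         n≤1+n; *-suc; *-assoc; *-monoʳ-≤; ≤-reflexive; ≤-trans; <-irrefl; m≤m+n; 1+n≢n; suc-injective; m≤n⇒m<n∨m≡n; module ≤-Reasoning)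
  renaming (_≟_ to _≟ℕ_)
open import Data.Nat.DivMod using (m≡m%n+[m/n]*n; m*n/n≡m)
open import Data.Nat.Tactic.RingSolver using (solve-∀)
open import Data.Product using (∃-syntax; _,_)
open import Data.Product.Properties using (≡-dec; ,-injectiveˡ; ,-injectiveʳ)
open import Data.Sum using (_⊎_; inj₁; inj₂)
open import Function using (_∘_; Equivalence)
open import Relation.Binary.PropositionalEquality using (_≢_; refl; sym; trans; cong; cong₂; subst; subst₂; module ≡-Reasoning)
open import Relation.Nullary using (Dec; yes; no; does; proof; _because_)
open import Relation.Nullary.Decidable using (T?; _×-dec_; _→-dec_; map′; from-yes; dec-true; dec-false)
open import Relation.Nullary.Reflects using (invert; det)

open import Algebra.Properties.Semiring.Sum +-*-semiring using (sum; sum-syntax; ∑-distrib-+; sum-remove; sum-cong-≗; *-distribˡ-sum)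
open Equivalence using (from)

indicator : Bool → ℕ
indicator b = if b then 1 else 0

indicator-∨ : ∀ x y → (T x → T y → ⊥) → indicator (x ∨ y) ≡ indicator x + indicator y
indicator-∨ true  true  exclusive = ⊥-elim (exclusive _ _)
indicator-∨ true  false _         = refl
indicator-∨ false _     _         = refl

exactlyOne : Bool → Bool → Bool → Bool → Bool
exactlyOne true  b     c     d = not (b ∨ c ∨ d)
exactlyOne false true  c     d = not (c ∨ d)
exactlyOne false false true  d = not d
exactlyOne false false false d = d

exactlyOne-intro : ∀ {a b c d} → T (a ∨ b ∨ c ∨ d) →
  (T a → T b → ⊥) → (T a → T c → ⊥) → (T a → T d → ⊥) →
  (T b → T c → ⊥) → (T b → T d → ⊥) → (T c → T d → ⊥) →
  T (exactlyOne a b c d)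
exactlyOne-intro {true}  {true}                  _ ab _  _  _  _  _  = ab _ _
exactlyOne-intro {true}  {false} {true}          _ _  ac _  _  _  _  = ac _ _
exactlyOne-intro {true}  {false} {false} {true}  _ _  _  ad _  _  _  = ad _ _
exactlyOne-intro {true}  {false} {false} {false} _ _  _  _  _  _  _  = _
exactlyOne-intro {false} {true}  {true}          _ _  _  _  bc _  _  = bc _ _
exactlyOne-intro {false} {true}  {false} {true}  _ _  _  _  _  bd _  = bd _ _
exactlyOne-intro {false} {true}  {false} {false} _ _  _  _  _  _  _  = _
exactlyOne-intro {false} {false} {true}  {true}  _ _  _  _  _  _  cd = cd _ _
exactlyOne-intro {false} {false} {true}  {false} _ _  _  _  _  _  _  = _
exactlyOne-intro {false} {false} {false} {true}  _ _  _  _  _  _  _  = _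

∨-introˡ : ∀ {x} y → T x → T (x ∨ y)
∨-introˡ {true} _ _ = _

∨-introʳ : ∀ x {y} → T y → T (x ∨ y)
∨-introʳ true  _ = _
∨-introʳ false t = t

both : ∀ {a b} → T a → T b → T (a ∧ b)
both ta tb = from T-∧ (ta , tb)

does⇒ : ∀ {A : Set} (a? : Dec A) → T (does a?) → A
does⇒ (true because [a]) _ = invert [a]

⇒does : ∀ {A : Set} (a? : Dec A) → A → T (does a?)
⇒does a? a = subst T (sym (dec-true a? a)) _

does-cong : ∀ {A B : Set} → (A → B) → (B → A) → (a? : Dec A) (b? : Dec B) → does a? ≡ does b?
does-cong f g a? b? = det (proof (map′ f g a?)) (proof b?)

point≤sum : ∀ {n} (f : Fin n → ℕ) i → f i ≤ sum f
point≤sum {suc n} f i = subst (f i ≤_) (sym (sum-remove {i = i} f)) (m≤m+n (f i) _)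

telescope : (φ w : ℕ → ℕ) (c : ℕ) → (∀ k → φ k + w k ≤ c + φ (suc k)) →
            ∀ n → φ 0 + ∑[ k < n ] w (toℕ k) ≤ n * c + φ n
telescope φ w c step zero    = ≤-reflexive (+-identityʳ (φ 0))
telescope φ w c step (suc n) = begin
  φ 0 + (w 0 + S)          ≡⟨ +-assoc (φ 0) (w 0) S ⟨
  (φ 0 + w 0) + S          ≤⟨ +-monoˡ-≤ S (step 0) ⟩
  (c + φ 1) + S            ≡⟨ +-assoc c (φ 1) S ⟩
  c + (φ 1 + S)            ≤⟨ +-monoʳ-≤ c (telescope (φ ∘ suc) (w ∘ suc) c (step ∘ suc) n) ⟩
  c + (n * c + φ (suc n))  ≡⟨ +-assoc c (n * c) _ ⟨
  suc n * c + φ (suc n)    ∎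
  where
  open ≤-Reasoning
  S = ∑[ k < n ] w (suc (toℕ k))

-- Induced matchings in a grid

module _ {n m : ℕ} where

  private
    variable
      u v w₁ w₂ : Vertex n m
      e e′ : Edge n m
      M : List (Edge n m)

  pathAdj-irreflexive : ∀ {k} {a : Fin k} → ¬ PathAdj a a
  pathAdj-irreflexive (inj₁ eq) = 1+n≢n eq
  pathAdj-irreflexive (inj₂ eq) = 1+n≢n eq

  adjacent⇒≢ : GridAdj u v → u ≢ v
  adjacent⇒≢ (inj₁ (_ , adj)) refl = pathAdj-irreflexive adj
  adjacent⇒≢ (inj₂ (_ , adj)) refl = pathAdj-irreflexive adj

  adjacent-sym : GridAdj u v → GridAdj v u
  adjacent-sym (inj₁ (eq , inj₁ adj)) = inj₁ (sym eq , inj₂ adj)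
  adjacent-sym (inj₁ (eq , inj₂ adj)) = inj₁ (sym eq , inj₁ adj)
  adjacent-sym (inj₂ (eq , inj₁ adj)) = inj₂ (sym eq , inj₂ adj)
  adjacent-sym (inj₂ (eq , inj₂ adj)) = inj₂ (sym eq , inj₁ adj)

  endpoints-separated : EdgesSeparated e e′ → Saturates e u → Saturates e′ v → Separated u v
  endpoints-separated (ac , _  , _  , _ ) (inj₁ refl) (inj₁ refl) = ac
  endpoints-separated (_  , ad , _  , _ ) (inj₁ refl) (inj₂ refl) = ad
  endpoints-separated (_  , _  , bc , _ ) (inj₂ refl) (inj₁ refl) = bc
  endpoints-separated (_  , _  , _  , bd) (inj₂ refl) (inj₂ refl) = bd

  other-endpoint : GridAdj (proj₁ e) (proj₂ e) → Saturates e v → ∃[ u ] GridAdj v u × Saturates e u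
  other-endpoint adj (inj₁ refl) = _ , adj , inj₂ refl
  other-endpoint adj (inj₂ refl) = _ , adjacent-sym adj , inj₁ refl

  other-endpoint-unique : Saturates e v → Saturates e w₁ → Saturates e w₂ → w₁ ≢ v → w₂ ≢ v → w₁ ≡ w₂
  other-endpoint-unique (inj₁ refl) (inj₁ refl) _           w₁≢v _    = ⊥-elim (w₁≢v refl)
  other-endpoint-unique (inj₁ refl) (inj₂ refl) (inj₁ refl) _    w₂≢v = ⊥-elim (w₂≢v refl)
  other-endpoint-unique (inj₁ refl) (inj₂ refl) (inj₂ refl) _    _    = refl
  other-endpoint-unique (inj₂ refl) (inj₁ refl) (inj₁ refl) _    _    = refl
  other-endpoint-unique (inj₂ refl) (inj₁ refl) (inj₂ refl) _    w₂≢v = ⊥-elim (w₂≢v refl)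
  other-endpoint-unique (inj₂ refl) (inj₂ refl) _           w₁≢v _    = ⊥-elim (w₁≢v refl)

  saturated-lookup : ∀ p → Saturates (lookup M p) v → IsSaturated M v
  saturated-lookup p s = Any.map (λ eq → subst (λ e → Saturates e _) eq s) (∈-lookup p)

  tail-induced : IsInducedMatching (e ∷ M) → IsInducedMatching M
  tail-induced (adj , sep) = adj ∘ suc , λ p q p≢q → sep (suc p) (suc q) (p≢q ∘ Fin-suc-injective)

  head-unsaturated : IsInducedMatching (e ∷ M) → Saturates e v → ¬ IsSaturated M v
  head-unsaturated (_ , sep) s sat =
    proj₁ (endpoints-separated (sep zero (suc (index sat)) λ ()) s (lookup-index sat)) refl

  saturated-neighbour : IsInducedMatching M → IsSaturated M v → ∃[ u ] GridAdj v u × IsSaturated M u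
  saturated-neighbour (adj , _) sat =
    let u , v~u , s = other-endpoint (adj (index sat)) (lookup-index sat)
    in  u , v~u , saturated-lookup (index sat) s

  -- Matching edges other than v's own are separated from v's edge, so both neighbours lie on it.
  saturated-neighbour-unique : IsInducedMatching M → IsSaturated M v →
    GridAdj v w₁ → IsSaturated M w₁ → GridAdj v w₂ → IsSaturated M w₂ → w₁ ≡ w₂
  saturated-neighbour-unique {M = M} (_ , sep) sat a₁ s₁ a₂ s₂ =
    other-endpoint-unique (lookup-index sat) (on-edge a₁ s₁) (on-edge a₂ s₂)
      (adjacent⇒≢ a₁ ∘ sym) (adjacent⇒≢ a₂ ∘ sym)
    where
    on-edge : ∀ {u} → GridAdj _ u → IsSaturated M u → Saturates (lookup M (index sat)) u
    on-edge adj s with index sat ≟ᶠ index s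
    ... | yes p≡q = subst (λ p → Saturates (lookup M p) _) (sym p≡q) (lookup-index s)
    ... | no  p≢q = ⊥-elim (proj₂ (endpoints-separated (sep _ _ p≢q) (lookup-index sat) (lookup-index s)) adj)

  ∑ᵥ : (Vertex n m → ℕ) → ℕ
  ∑ᵥ F = ∑[ J < m ] ∑[ r < n ] F (r , J)

  ∑ᵥ-distrib-+ : ∀ F G → ∑ᵥ (λ v → F v + G v) ≡ ∑ᵥ F + ∑ᵥ G
  ∑ᵥ-distrib-+ F G =
    trans (sum-cong-≗ λ J → ∑-distrib-+ (λ r → F (r , J)) (λ r → G (r , J)))
          (∑-distrib-+ (λ J → ∑[ r < n ] F (r , J)) (λ J → ∑[ r < n ] G (r , J)))

  point≤∑ᵥ : ∀ F (v : Vertex n m) → F v ≤ ∑ᵥ F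
  point≤∑ᵥ F (r , J) = ≤-trans (point≤sum (λ r → F (r , J)) r) (point≤sum (λ J → ∑[ r < n ] F (r , J)) J)

  saturatedCount : List (Edge n m) → ℕ
  saturatedCount M = ∑ᵥ λ v → indicator (does (isSaturated? M v))

  twice-length≤saturatedCount : IsInducedMatching M → 2 * length M ≤ saturatedCount M
  twice-length≤saturatedCount {[]}          _   = z≤n
  twice-length≤saturatedCount {(a , b) ∷ M} ind = begin
    2 * suc (length M)                             ≡⟨ *-suc 2 (length M) ⟩
    (1 + 1) + 2 * length M                         ≤⟨ +-mono-≤ (+-mono-≤ (self a) (self b)) ih ⟩
    (∑ᵥ (at a) + ∑ᵥ (at b)) + saturatedCount M    ≡⟨ cong (_+ _) (∑ᵥ-distrib-+ (at a) (at b)) ⟨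
    ∑ᵥ (λ v → at a v + at b v) + saturatedCount M  ≡⟨ ∑ᵥ-distrib-+ (λ v → at a v + at b v) (saturated M) ⟨
    ∑ᵥ (λ v → (at a v + at b v) + saturated M v)   ≡⟨ sum-cong-≗ (λ J → sum-cong-≗ λ r → sym (split (r , J))) ⟩
    saturatedCount ((a , b) ∷ M)                   ∎
    where
    open ≤-Reasoning
    ih : 2 * length M ≤ saturatedCount M
    ih = twice-length≤saturatedCount {M = M} (tail-induced ind)
    _≟_ : (x y : Vertex n m) → Dec (x ≡ y)
    _≟_ = ≡-dec _≟ᶠ_ _≟ᶠ_
    at : Vertex n m → Vertex n m → ℕ
    at x v = indicator (does (x ≟ v))
    saturated : List (Edge n m) → Vertex n m → ℕ
    saturated M v = indicator (does (isSaturated? M v))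
    self : ∀ x → 1 ≤ ∑ᵥ (at x)
    self x = subst (_≤ ∑ᵥ (at x)) (cong indicator (dec-true (x ≟ x) refl)) (point≤∑ᵥ (at x) x)
    split : ∀ v → saturated ((a , b) ∷ M) v ≡ (at a v + at b v) + saturated M v
    split v = trans
      (indicator-∨ (does (saturates? (a , b) v)) _ λ s s′ →
        head-unsaturated {M = M} ind (does⇒ (saturates? (a , b) v) s) (does⇒ (isSaturated? M v) s′))
      (cong (_+ _) (indicator-∨ (does (a ≟ v)) (does (b ≟ v)) λ a≡v b≡v →
        adjacent⇒≢ (proj₁ ind zero) (trans (does⇒ (a ≟ v) a≡v) (sym (does⇒ (b ≟ v) b≡v)))))

data Direction : Set where
  left right up down : Direction

rowOffset columnOffset : Direction → ℕ
rowOffset left    = 1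
rowOffset right   = 1
rowOffset up      = 0
rowOffset down    = 2
columnOffset left  = 0
columnOffset right = 2
columnOffset up    = 1
columnOffset down  = 1

-- The four positions around (1 + i , 1 + k).
around : ℕ → ℕ → Direction → ℕ × ℕ
around i k d = rowOffset d + i , columnOffset d + k

someDirection : (f : Direction → Bool) → ∀ d → T (f d) → T (f left ∨ f right ∨ f up ∨ f down)
someDirection f left  t = ∨-introˡ _ t
someDirection f right t = ∨-introʳ (f left) (∨-introˡ _ t)
someDirection f up    t = ∨-introʳ (f left) (∨-introʳ (f right) (∨-introˡ _ t))
someDirection f down  t = ∨-introʳ (f left) (∨-introʳ (f right) (∨-introʳ (f up) t))

module _ {n m : ℕ} where

  private
    variable
      r : Fin n
      J : Fin m
      u : Vertex n m
      M : List (Edge n m)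

  -- Rows are shifted by one and columns by two, so that the border rows see an empty row
  -- above and below them, and the grid is preceded by two empty columns.
  position : Vertex n m → ℕ × ℕ
  position (r , J) = suc (toℕ r) , suc (suc (toℕ J))

  position-injective : ∀ {u v} → position u ≡ position v → u ≡ v
  position-injective eq =
    cong₂ _,_ (toℕ-injective (suc-injective (,-injectiveˡ eq)))
              (toℕ-injective (suc-injective (suc-injective (,-injectiveʳ eq))))

  Occupied : List (Edge n m) → ℕ × ℕ → Set
  Occupied M x = ∃[ v ] position v ≡ x × IsSaturated M v

  occupied? : ∀ M x → Dec (Occupied M x)
  occupied? M x = map′ (λ (r , J , p) → (r , J) , p) (λ ((r , J) , p) → r , J , p)
    (Finₚ.any? λ r → Finₚ.any? λ J → ≡-dec _≟ℕ_ _≟ℕ_ (position (r , J)) x ×-dec isSaturated? M (r , J))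

  occupied : List (Edge n m) → ℕ × ℕ → Bool
  occupied M x = does (occupied? M x)

  occupied-position : ∀ M v → occupied M (position v) ≡ does (isSaturated? M v)
  occupied-position M v = does-cong
    (λ (u , eq , s) → subst (IsSaturated M) (position-injective eq) s) (λ s → v , refl , s)
    (occupied? M (position v)) (isSaturated? M v)

  occupied-row₀ : ∀ M k → occupied M (0 , k) ≡ false
  occupied-row₀ M k = dec-false (occupied? M _) λ { (_ , () , _) }

  occupied-below : ∀ M k → occupied M (suc n , k) ≡ false
  occupied-below M k = dec-false (occupied? M _) λ { ((r , _) , eq , _) →
    <-irrefl (suc-injective (,-injectiveˡ eq)) (toℕ<n r) }

  occupied-column₀ : ∀ M i → occupied M (i , 0) ≡ false
  occupied-column₀ M i = dec-false (occupied? M _) λ { (_ , () , _) }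

  occupied-column₁ : ∀ M i → occupied M (i , 1) ≡ false
  occupied-column₁ M i = dec-false (occupied? M _) λ { (_ , () , _) }

  occupied-beyond : ∀ M i → occupied M (i , suc (suc m)) ≡ false
  occupied-beyond M i = dec-false (occupied? M _) λ { ((_ , J) , eq , _) →
    <-irrefl (suc-injective (suc-injective (,-injectiveʳ eq))) (toℕ<n J) }

  adjacent⇒around : GridAdj (r , J) u → ∃[ d ] position u ≡ around (toℕ r) (suc (toℕ J)) d
  adjacent⇒around {r = r} (inj₁ (refl , inj₁ eq)) = right , cong (λ j → suc (toℕ r) , suc (suc j)) (sym eq)
  adjacent⇒around {r = r} (inj₁ (refl , inj₂ eq)) = left  , cong (λ j → suc (toℕ r) , suc j) eq
  adjacent⇒around {J = J} (inj₂ (refl , inj₁ eq)) = down  , cong (λ i → suc i , suc (suc (toℕ J))) (sym eq)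
  adjacent⇒around {J = J} (inj₂ (refl , inj₂ eq)) = up    , cong (_, suc (suc (toℕ J))) eq

  private
    aligned : ∀ {k} {a b : Fin k} → suc (toℕ b) ≡ suc (toℕ a) → a ≡ b
    aligned eq = toℕ-injective (sym (suc-injective eq))

  around⇒adjacent : ∀ d → position u ≡ around (toℕ r) (suc (toℕ J)) d → GridAdj (r , J) u
  around⇒adjacent left  eq = inj₁ (aligned (,-injectiveˡ eq) , inj₂ (suc-injective (,-injectiveʳ eq)))
  around⇒adjacent right eq = inj₁ (aligned (,-injectiveˡ eq) , inj₁ (sym (suc-injective (suc-injective (,-injectiveʳ eq)))))
  around⇒adjacent up    eq = inj₂ (aligned (suc-injective (,-injectiveʳ eq)) , inj₂ (,-injectiveˡ eq))
  around⇒adjacent down  eq = inj₂ (aligned (suc-injective (,-injectiveʳ eq)) , inj₁ (sym (suc-injective (,-injectiveˡ eq))))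

  occupiedAround : List (Edge n m) → ℕ → ℕ → Direction → Bool
  occupiedAround M i k d = occupied M (around i k d)

  saturated-exactlyOne : IsInducedMatching M → IsSaturated M (r , J) →
    let f = occupiedAround M (toℕ r) (suc (toℕ J)) in T (exactlyOne (f left) (f right) (f up) (f down))
  saturated-exactlyOne {M = M} {r = r} {J = J} ind sat =
    exactlyOne-intro (someDirection f _ (proj₂ neighbour))
      (distinct left right λ _ _ ()) (distinct left up λ _ _ ()) (distinct left down λ _ _ ())
      (distinct right up λ _ _ ()) (distinct right down λ _ _ ()) (distinct up down λ _ _ ())
    where
    f = occupiedAround M (toℕ r) (suc (toℕ J))
    neighbour : ∃[ d ] T (f d)
    neighbour with saturated-neighbour ind sat
    ... | u , adj , s with adjacent⇒around adj
    ...   | d , eq = d , ⇒does (occupied? M _) (u , eq , s)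
    same : ∀ {d e} → T (f d) → T (f e) → around (toℕ r) (suc (toℕ J)) d ≡ around (toℕ r) (suc (toℕ J)) e
    same {d} {e} t t′ with does⇒ (occupied? M _) t | does⇒ (occupied? M _) t′
    ... | u , eq , s | u′ , eq′ , s′ =
      trans (sym eq) (trans (cong position (saturated-neighbour-unique ind sat
        (around⇒adjacent d eq) s (around⇒adjacent e eq′) s′)) eq′)
    distinct : ∀ d e → (∀ i k → around i k d ≢ around i k e) → T (f d) → T (f e) → ⊥
    distinct _ _ d≢e t t′ = d≢e _ _ (same t t′)

  occupied-exactlyOne : IsInducedMatching M → ∀ i k → T (occupied M (suc i , suc k)) →
    T (exactlyOne (occupied M (suc i , k)) (occupied M (suc i , suc (suc k)))
                  (occupied M (i , suc k)) (occupied M (suc (suc i) , suc k)))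
  occupied-exactlyOne {M = M} ind i k t with does⇒ (occupied? M _) t
  ... | (r , J) , refl , sat = saturated-exactlyOne ind sat

-- Columns of a four-row grid

Column : Set
Column = Bool × Bool × Bool × Bool

empty : Column
empty = false , false , false , false

row₄ : Column → Bool
row₄ (_ , _ , _ , d) = d

weight : Column → ℕ
weight (a , b , c , d) = 4 * (indicator a + indicator b + indicator c) + 2 * indicator d

vertexMatched : (self left right up down : Bool) → Bool
vertexMatched v l r u d = not v ∨ exactlyOne l r u d

vertexMatched-intro : ∀ v l r u d → (T v → T (exactlyOne l r u d)) → T (vertexMatched v l r u d)
vertexMatched-intro false _ _ _ _ _ = _
vertexMatched-intro true  _ _ _ _ h = h _

wellMatched : (previous current next : Column) → Bool
wellMatched (p₁ , p₂ , p₃ , p₄) (c₁ , c₂ , c₃ , c₄) (x₁ , x₂ , x₃ , x₄) =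
  vertexMatched c₁ p₁ x₁ false c₂ ∧ vertexMatched c₂ p₂ x₂ c₁ c₃ ∧
  vertexMatched c₃ p₃ x₃ c₂ c₄ ∧ vertexMatched c₄ p₄ x₄ c₃ false

module _ {m : ℕ} where

  private
    variable
      M : List (Edge 4 m)

  column : List (Edge 4 m) → ℕ → Column
  column M k = occupied M (1 , k) , occupied M (2 , k) , occupied M (3 , k) , occupied M (4 , k)

  column-wellMatched : IsInducedMatching M → ∀ k →
    T (wellMatched (column M k) (column M (suc k)) (column M (suc (suc k))))
  column-wellMatched {M = M} ind k =
    both (vertex 0 (occupied-row₀ M (suc k)) refl)
      (both (vertex 1 refl refl) (both (vertex 2 refl refl) (vertex 3 refl (occupied-below M (suc k)))))
    where
    vertex : ∀ i {u d} → occupied M (i , suc k) ≡ u → occupied M (suc (suc i) , suc k) ≡ d →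
      T (vertexMatched (occupied M (suc i , suc k)) (occupied M (suc i , k)) (occupied M (suc i , suc (suc k))) u d)
    vertex i refl refl = vertexMatched-intro (occupied M (suc i , suc k)) (occupied M (suc i , k))
      (occupied M (suc i , suc (suc k))) (occupied M (i , suc k)) (occupied M (suc (suc i) , suc k))
      (occupied-exactlyOne ind i k)

  column-empty : ∀ {k} → (∀ i → occupied M (i , k) ≡ false) → column M k ≡ empty
  column-empty none = cong₂ _,_ (none 1) (cong₂ _,_ (none 2) (cong₂ _,_ (none 3) (none 4)))

  column-grid : ∀ J → column M (suc (suc (toℕ J))) ≡
    (does (isSaturated? M (0F , J)) , does (isSaturated? M (1F , J)) ,
     does (isSaturated? M (2F , J)) , does (isSaturated? M (3F , J)))
  column-grid {M = M} J = cong₂ _,_ (row 0F) (cong₂ _,_ (row 1F) (cong₂ _,_ (row 2F) (row 3F)))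
    where
    row : ∀ r → occupied M (position (r , J)) ≡ does (isSaturated? M (r , J))
    row r = occupied-position M (r , J)

length-filter-tabulate : ∀ {A : Set} {P : A → Set} (P? : ∀ x → Dec (P x)) {k} (f : Fin k → A) →
  length (filter P? (tabulate f)) ≡ ∑[ i < k ] indicator (does (P? (f i)))
length-filter-tabulate P? {zero}  f = refl
length-filter-tabulate P? {suc k} f with does (P? (f zero))
... | true  = cong suc (length-filter-tabulate P? (f ∘ suc))
... | false = length-filter-tabulate P? (f ∘ suc)

-- The right-hand side is ∑[ r < 4 ] unfolded, which is how it reduces.
weight-count : ∀ a b c d → weight (a , b , c , d) + 2 * indicator d ≡
  4 * (indicator a + (indicator b + (indicator c + (indicator d + 0))))
weight-count a b c d = arithmetic (indicator a) (indicator b) (indicator c) (indicator d)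
  where
  arithmetic : ∀ a b c d → 4 * (a + b + c) + 2 * d + 2 * d ≡ 4 * (a + (b + (c + (d + 0))))
  arithmetic = solve-∀

module _ {m : ℕ} (M : List (Edge 4 m)) where

  weighted-count : ∑[ J < m ] weight (column M (suc (suc (toℕ J)))) + 2 * rowSaturatedCount M (fromℕ 3)
                 ≡ 4 * saturatedCount M
  weighted-count = begin
    ∑[ J < m ] w J + 2 * rowSaturatedCount M 3F       ≡⟨ cong (λ c → ∑[ J < m ] w J + 2 * c) row-count ⟩
    ∑[ J < m ] w J + 2 * ∑[ J < m ] s 3F J            ≡⟨ cong (∑[ J < m ] w J +_) (*-distribˡ-sum 2 (s 3F)) ⟩
    ∑[ J < m ] w J + ∑[ J < m ] (2 * s 3F J)          ≡⟨ ∑-distrib-+ w (λ J → 2 * s 3F J) ⟨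
    ∑[ J < m ] (w J + 2 * s 3F J)                     ≡⟨ sum-cong-≗ per-column ⟩
    ∑[ J < m ] (4 * ∑[ r < 4 ] s r J)                 ≡⟨ *-distribˡ-sum 4 (λ J → ∑[ r < 4 ] s r J) ⟨
    4 * saturatedCount M                              ∎
    where
    open ≡-Reasoning
    row-count = length-filter-tabulate (λ J → isSaturated? M (3F , J)) (λ J → J)
    s : Fin 4 → Fin m → ℕ
    s r J = indicator (does (isSaturated? M (r , J)))
    w : Fin m → ℕ
    w J = weight (column M (suc (suc (toℕ J))))
    per-column : ∀ J → w J + 2 * s 3F J ≡ 4 * ∑[ r < 4 ] s r J
    per-column J = trans (cong (λ c → weight c + 2 * s 3F J) (column-grid J))
      (weight-count (does (isSaturated? M (0F , J))) (does (isSaturated? M (1F , J)))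
                    (does (isSaturated? M (2F , J))) (does (isSaturated? M (3F , J))))

-- The potential certificate

data Cell : Set where
  ○ ◐ ● ✗ : Cell

-- State of a vertex of the current column, given the previous column: ○ unsaturated,
-- ◐ saturated with no saturated neighbour on its left or in its column (so its partner
-- lies to the right), ● saturated with exactly one such neighbour, ✗ with two or more.
cell : (saturated : Bool) → (neighbours : ℕ) → Cell
cell false _               = ○
cell true  0               = ◐
cell true  1               = ●
cell true  (suc (suc _))   = ✗

classify : (previous current : Column) → Cell × Cell × Cell × Cell
classify (p₁ , p₂ , p₃ , p₄) (c₁ , c₂ , c₃ , c₄) =
  cell c₁ (indicator p₁ + indicator c₂) ,
  cell c₂ (indicator p₂ + indicator c₁ + indicator c₃) ,
  cell c₃ (indicator p₃ + indicator c₂ + indicator c₄) ,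
  cell c₄ (indicator p₄ + indicator c₃)

record State : Set where
  constructor state
  field
    previous current : Column
    rowFourPairSeen odd : Bool

next : State → Column → State
next (state p c h o) x = state c x (h ∨ (row₄ c ∧ row₄ x)) (not o)

select : (a b c d : ℕ) → Bool → Bool → ℕ
select a b c d false false = a
select a b c d false true  = b
select a b c d true  false = c
select a b c d true  true  = d

-- Computed offline, essentially as the largest excess Σ (weight − 7) of a well-matched
-- column sequence reaching the state from two empty columns, shifted by 8; all that
-- matters is potential-step below, which is checked exhaustively.  Pairs whose current
-- column contains a ✗ admit no well-matched successor, so any large value serves there.
table : Cell × Cell × Cell × Cell → Bool → Bool → ℕ
table (● , ● , ○ , ●) = select 8 9 8 7
table (● , ● , ○ , ◐) = select 6 11 6 5
table (● , ● , ○ , ○) = select 8 9 4 7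
table (● , ○ , ● , ●) = select 8 9 8 7
table (● , ○ , ● , ○) = select 10 5 10 5
table (● , ○ , ◐ , ○) = select 6 7 6 5
table (● , ○ , ○ , ●) = select 8 3 6 7
table (● , ○ , ○ , ◐) = select 6 5 4 5
table (● , ○ , ○ , ○) = select 8 3 4 3
table (◐ , ○ , ● , ●) = select 6 11 6 7
table (◐ , ○ , ● , ○) = select 6 7 6 5
table (◐ , ○ , ◐ , ○) = select 4 9 4 9
table (◐ , ○ , ○ , ●) = select 6 5 4 5
table (◐ , ○ , ○ , ◐) = select 8 7 6 7
table (◐ , ○ , ○ , ○) = select 6 5 4 5
table (○ , ● , ● , ○) = select 4 9 8 7
table (○ , ● , ○ , ●) = select 8 3 8 3
table (○ , ● , ○ , ◐) = select 6 5 6 3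
table (○ , ● , ○ , ○) = select 4 3 4 1
table (○ , ◐ , ○ , ●) = select 6 7 4 5
table (○ , ◐ , ○ , ◐) = select 4 9 4 9
table (○ , ◐ , ○ , ○) = select 6 7 4 7
table (○ , ○ , ● , ●) = select 8 7 6 3
table (○ , ○ , ● , ○) = select 4 3 2 3
table (○ , ○ , ◐ , ○) = select 6 5 4 5
table (○ , ○ , ○ , ●) = select 8 3 6 1
table (○ , ○ , ○ , ◐) = select 4 5 2 5
table (○ , ○ , ○ , ○) = select 8 3 0 3
table _               = select 16 16 16 16

potential : State → ℕ
potential (state p c h o) = table (classify p c) h o

PotentialStep : State → Column → Set
PotentialStep s x = T (wellMatched (State.previous s) (State.current s) x) →
                    potential s + weight x ≤ 7 + potential (next s x)

∀-Bool? : {P : Bool → Set} → (∀ b → Dec (P b)) → Dec (∀ b → P b)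
∀-Bool? P? = map′ (λ (f , t) → λ { false → f ; true → t }) (λ h → h false , h true) (P? false ×-dec P? true)

∀-Column? : {P : Column → Set} → (∀ c → Dec (P c)) → Dec (∀ c → P c)
∀-Column? P? = map′ (λ h (a , b , c , d) → h a b c d) (λ h a b c d → h (a , b , c , d))
  (∀-Bool? λ a → ∀-Bool? λ b → ∀-Bool? λ c → ∀-Bool? λ d → P? (a , b , c , d))

∀-State? : {P : State → Set} → (∀ s → Dec (P s)) → Dec (∀ s → P s)
∀-State? P? = map′ (λ h (state p c r o) → h p c r o) (λ h p c r o → h (state p c r o))
  (∀-Column? λ p → ∀-Column? λ c → ∀-Bool? λ r → ∀-Bool? λ o → P? (state p c r o))

potentialStep? : ∀ s x → Dec (PotentialStep s x)
potentialStep? s x = T? (wellMatched (State.previous s) (State.current s) x) →-dec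
                     (potential s + weight x ≤? 7 + potential (next s x))

potential-step : ∀ s x → PotentialStep s x
potential-step = from-yes (∀-State? λ s → ∀-Column? (potentialStep? s))

parity : ℕ → Bool
parity zero    = false
parity (suc k) = not (parity k)

parity-double : ∀ t → parity (t * 2) ≡ false
parity-double zero    = refl
parity-double (suc t) = trans (not-involutive (parity (t * 2))) (parity-double t)

module _ {m : ℕ} (M : List (Edge 4 m)) where

  rowFourPairBefore : ℕ → Bool
  rowFourPairBefore zero    = false
  rowFourPairBefore (suc k) = rowFourPairBefore k ∨ (row₄ (column M (suc k)) ∧ row₄ (column M (suc (suc k))))

  rowFourPairBefore-mono : ∀ {k} l → k ≤ l → T (rowFourPairBefore k) → T (rowFourPairBefore l)
  rowFourPairBefore-mono l k≤l t with m≤n⇒m<n∨m≡n k≤l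
  rowFourPairBefore-mono l       _ t | inj₂ refl        = t
  rowFourPairBefore-mono (suc l) _ t | inj₁ (s≤s k≤l′) = ∨-introˡ _ (rowFourPairBefore-mono l k≤l′ t)

  walk : ℕ → State
  walk k = state (column M k) (column M (suc k)) (rowFourPairBefore k) (parity k)

  weight-bound : IsInducedMatching M → parity m ≡ true → T (rowFourPairBefore (suc m)) →
                 ∑[ J < m ] weight (column M (suc (suc (toℕ J)))) < m * 7
  weight-bound ind odd seen = +-cancelˡ-≤ 7 _ _ (begin
    8 + W                        ≡⟨ cong (_+ W) initial ⟨
    potential (walk 0) + W       ≤⟨ telescope (potential ∘ walk) (λ k → weight (column M (suc (suc k)))) 7 step m ⟩
    m * 7 + potential (walk m)   ≤⟨ +-monoʳ-≤ (m * 7) finish ⟩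
    m * 7 + 7                    ≡⟨ +-comm (m * 7) 7 ⟩
    7 + m * 7                    ∎)
    where
    open ≤-Reasoning
    W = ∑[ J < m ] weight (column M (suc (suc (toℕ J))))
    step : ∀ k → potential (walk k) + weight (column M (suc (suc k))) ≤ 7 + potential (walk (suc k))
    step k = potential-step (walk k) (column M (suc (suc k))) (column-wellMatched ind k)
    initial : potential (walk 0) ≡ 8
    initial = cong₂ (λ p c → potential (state p c false false))
      (column-empty {M = M} (occupied-column₀ M)) (column-empty {M = M} (occupied-column₁ M))
    end : walk (suc m) ≡ state (column M (suc m)) empty true false
    end = cong₂ (λ c (h , o) → state (column M (suc m)) c h o)
      (column-empty {M = M} (occupied-beyond M)) (cong₂ _,_ (Equivalence.to T-≡ seen) (cong not odd))
    finish : potential (walk m) ≤ 7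
    finish = begin
      potential (walk m)                                     ≤⟨ m≤m+n _ _ ⟩
      potential (walk m) + weight (column M (suc (suc m)))   ≤⟨ step m ⟩
      7 + potential (walk (suc m))                           ≡⟨ cong (λ s → 7 + potential s) end ⟩
      7                                                      ∎

  rowFourPair-seen : ∀ K K′ → suc (toℕ K) ≡ toℕ K′ → IsSaturated M (3F , K) → IsSaturated M (3F , K′) →
                     T (rowFourPairBefore (suc m))
  rowFourPair-seen K K′ K→K′ s s′ =
    rowFourPairBefore-mono (suc m) (≤-trans (subst (λ j → suc j ≤ m) (sym K→K′) (toℕ<n K′)) (n≤1+n m))
      (∨-introʳ (rowFourPairBefore (suc (toℕ K)))
        (both (⇒does (occupied? M _) ((3F , K) , refl , s))
              (⇒does (occupied? M _) ((3F , K′) , cong (λ j → 4 , suc (suc j)) (sym K→K′) , s′))))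

  rowFourEdge-seen : IsInducedMatching M → ∀ {e} → e ∈ M →
    proj₁ (proj₁ e) ≡ fromℕ 3 → proj₁ (proj₂ e) ≡ fromℕ 3 → T (rowFourPairBefore (suc m))
  rowFourEdge-seen (adj , _) {(_ , J) , (_ , J′)} e∈M refl refl
    with subst (λ e → GridAdj (proj₁ e) (proj₂ e)) (sym (lookup-index e∈M)) (adj (index e∈M))
  ... | inj₁ (_ , inj₁ J→J′) = rowFourPair-seen J J′ J→J′ (Any.map (λ { refl → inj₁ refl }) e∈M)
                                                          (Any.map (λ { refl → inj₂ refl }) e∈M)
  ... | inj₁ (_ , inj₂ J′→J) = rowFourPair-seen J′ J J′→J (Any.map (λ { refl → inj₂ refl }) e∈M)
                                                          (Any.map (λ { refl → inj₁ refl }) e∈M)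
  ... | inj₂ (_ , inj₁ ())
  ... | inj₂ (_ , inj₂ ())

  rowFourPair-length-bound : IsInducedMatching M → parity m ≡ true → T (rowFourPairBefore (suc m)) →
                             8 * length M < m * 7 + 2 * rowSaturatedCount M (fromℕ 3)
  rowFourPair-length-bound ind odd seen = begin-strict
    8 * length M                                        ≡⟨ *-assoc 4 2 (length M) ⟩
    4 * (2 * length M)                                  ≤⟨ *-monoʳ-≤ 4 (twice-length≤saturatedCount {M = M} ind) ⟩
    4 * saturatedCount M                                ≡⟨ weighted-count M ⟨
    ∑[ J < m ] weight (column M (suc (suc (toℕ J)))) + 2 * r₄ <⟨ +-monoˡ-< (2 * r₄) (weight-bound ind odd seen) ⟩
    m * 7 + 2 * r₄                                      ∎
    where
    open ≤-Reasoning
    r₄ = rowSaturatedCount M (fromℕ 3)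

-- An induced matching with one edge per column

lookup-tabulate′ : ∀ {A : Set} {k} (f : Fin k → A) (p : Fin (length (tabulate f))) →
                   lookup (tabulate f) p ≡ f (cast (length-tabulate f) p)
lookup-tabulate′ f p = trans
  (cong (lookup (tabulate f)) (sym (cast-involutive (sym (length-tabulate f)) (length-tabulate f) p)))
  (lookup-tabulate f (cast (length-tabulate f) p))

tabulate-induced : ∀ {k n m} (f : Fin k → Edge n m) → (∀ J → GridAdj (proj₁ (f J)) (proj₂ (f J))) →
  (∀ J K → J ≢ K → EdgesSeparated (f J) (f K)) → IsInducedMatching (tabulate f)
tabulate-induced f adj sep =
  (λ p → subst (λ e → GridAdj (proj₁ e) (proj₂ e)) (sym (lookup-tabulate′ f p)) (adj _)) ,
  (λ p q p≢q → subst₂ EdgesSeparated (sym (lookup-tabulate′ f p)) (sym (lookup-tabulate′ f q))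
                 (sep _ _ (p≢q ∘ cast-injective)))
  where
  eq = length-tabulate f
  cast-injective : ∀ {p q} → cast eq p ≡ cast eq q → p ≡ q
  cast-injective {p} {q} c = trans (sym (cast-involutive (sym eq) eq p))
                               (trans (cong (cast (sym eq)) c) (cast-involutive (sym eq) eq q))

module _ {m : ℕ} where

  verticalEdge : Bool → Fin m → Edge 4 m
  verticalEdge false J = (0F , J) , (1F , J)
  verticalEdge true  J = (2F , J) , (3F , J)

  other-column-separated : ∀ {r r′ : Fin 4} {J K : Fin m} → J ≢ K → (r ≡ r′ → ¬ PathAdj J K) →
                           Separated (r , J) (r′ , K)
  other-column-separated J≢K h =
    (λ eq → J≢K (,-injectiveʳ eq)) , λ { (inj₁ (eq , adj)) → h eq adj ; (inj₂ (eq , _)) → J≢K eq }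

  verticalEdge-separated : ∀ b b′ {J K : Fin m} → J ≢ K → (PathAdj J K → b ≢ b′) →
                           EdgesSeparated (verticalEdge b J) (verticalEdge b′ K)
  verticalEdge-separated false false J≢K h =
    other-column-separated J≢K (λ _ adj → h adj refl) , other-column-separated J≢K (λ ()) ,
    other-column-separated J≢K (λ ()) , other-column-separated J≢K (λ _ adj → h adj refl)
  verticalEdge-separated true  true  J≢K h =
    other-column-separated J≢K (λ _ adj → h adj refl) , other-column-separated J≢K (λ ()) ,
    other-column-separated J≢K (λ ()) , other-column-separated J≢K (λ _ adj → h adj refl)
  verticalEdge-separated false true  J≢K _ =
    other-column-separated J≢K (λ ()) , other-column-separated J≢K (λ ()) ,
    other-column-separated J≢K (λ ()) , other-column-separated J≢K (λ ())
  verticalEdge-separated true  false J≢K _ =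
    other-column-separated J≢K (λ ()) , other-column-separated J≢K (λ ()) ,
    other-column-separated J≢K (λ ()) , other-column-separated J≢K (λ ())

  alternatingEdge : Fin m → Edge 4 m
  alternatingEdge J = verticalEdge (parity (toℕ J)) J

  alternating-induced : IsInducedMatching (tabulate alternatingEdge)
  alternating-induced = tabulate-induced alternatingEdge (λ J → vertical (parity (toℕ J)))
    λ J K J≢K → verticalEdge-separated (parity (toℕ J)) (parity (toℕ K)) J≢K (parity-flips J K)
    where
    vertical : ∀ b {J} → GridAdj (proj₁ (verticalEdge b J)) (proj₂ (verticalEdge b J))
    vertical false = inj₂ (refl , inj₁ refl)
    vertical true  = inj₂ (refl , inj₁ refl)
    parity-flips : ∀ J K → PathAdj J K → parity (toℕ J) ≢ parity (toℕ K)
    parity-flips J K (inj₁ J→K) eq = not-¬ refl (trans eq (sym (cong parity J→K)))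
    parity-flips J K (inj₂ K→J) eq = not-¬ refl (trans (sym eq) (sym (cong parity K→J)))

  maximum⇒m≤length : ∀ {M : List (Edge 4 m)} → IsMaximumInducedMatching M → m ≤ length M
  maximum⇒m≤length {M} (_ , maximum) =
    subst (_≤ length M) (length-tabulate alternatingEdge) (maximum (tabulate alternatingEdge) alternating-induced)

-- Only m ≡ 1 (mod 4) is used.
lemma3p10 : (m : ℕ) → m % 4 ≡ 1 → 5 ≤ m →
    (M : List (Edge 4 m)) → IsMaximumInducedMatching M →
    rowSaturatedCount M (fromℕ 3) ≡ (m ∸ 1) / 2 →
    All (λ e → ¬ (proj₁ (proj₁ e) ≡ fromℕ 3 × proj₁ (proj₂ e) ≡ fromℕ 3)) M
lemma3p10 m m%4≡1 _ M maximum@(induced , _) rowCount =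
  All.tabulate λ e∈M (r₁ , r₂) → <-irrefl refl (impossible (rowFourEdge-seen M induced e∈M r₁ r₂))
  where
  q = m / 4
  m≡ : m ≡ suc (q * 4)
  m≡ = trans (m≡m%n+[m/n]*n m 4) (cong (_+ q * 4) m%4≡1)
  odd : parity m ≡ true
  odd = trans (cong parity m≡) (cong not (trans (cong parity (sym (*-assoc q 2 2))) (parity-double (q * 2))))
  half : rowSaturatedCount M (fromℕ 3) ≡ q * 2
  half = trans rowCount (trans (cong (λ n → (n ∸ 1) / 2) m≡)
                               (trans (cong (_/ 2) (sym (*-assoc q 2 2))) (m*n/n≡m (q * 2) 2)))
  arithmetic : ∀ q → suc (suc (q * 4) * 7 + 2 * (q * 2)) ≡ 8 * suc (q * 4)
  arithmetic = solve-∀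
  open ≤-Reasoning
  impossible : T (rowFourPairBefore M (suc m)) → 8 * m < 8 * m
  impossible seen = begin-strict
    8 * m                                      ≤⟨ *-monoʳ-≤ 8 (maximum⇒m≤length {M = M} maximum) ⟩
    8 * length M                               <⟨ rowFourPair-length-bound M induced odd seen ⟩
    m * 7 + 2 * rowSaturatedCount M (fromℕ 3)  ≡⟨ cong₂ (λ n r → n * 7 + 2 * r) m≡ half ⟩
    suc (q * 4) * 7 + 2 * (q * 2)              ≤⟨ n≤1+n _ ⟩
    suc (suc (q * 4) * 7 + 2 * (q * 2))        ≡⟨ arithmetic q ⟩
    8 * suc (q * 4)                            ≡⟨ cong (8 *_) m≡ ⟨
    8 * m                                      ∎
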